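{- Let $\mathcal{R}$ be a commutative Frobenius ring of characteristic $2$, let $n\ge1$, let $A$ be an $n\times n$ symmetric circulant matrix over $\mathcal{R}$, $B$ an $n\times n$ circulant matrix over $\mathcal{R}$, and $C$ an $n\times n$ reverse circulant matrix over $\mathcal{R}$. If $A^{2}+BB^{T}+C^{2}=I_{n}$, then the code of length $4n$ over $\mathcal{R}$ generated by the rows of $$G=\left( I_{2n}\ \middle|\ \begin{array}{cc} A & B+C \\ B^{T}+C & A\end{array}\right)$$ is self-dual.
   Context: A code of length $N$ over $\mathcal{R}$ is an $\mathcal{R}$-submodule of $\mathcal{R}^N$; the code generated by a matrix is the $\mathcal{R}$-submodule spanned by its rows. Duality is with respect to the Euclidean inner product $\langle x,y\rangle=\sum_i x_iy_i$, and a code $\mathcal{C}$ is self-dual if $\mathcal{C}=\mathcal{C}^\perp$. An $n\times n$ matrix is circulant if each row is the right cyclic shift of the previous row (with $\sigma(a_1,\dots,a_n)=(a_n,a_1,\dots,a_{n-1})$, row $i+1$ is $\sigma^{i}$ of the first row); it is reverse circulant if each row is the left cyclic shift of the previous row (row $i+1$ is $\sigma^{ -i}$ of the first row). A symmetric circulant matrix is a circulant matrix equal to its transpose. -}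

module Defs where

open import Level using (Level; _⊔_; Lift) renaming (suc to lsuc)
open import Algebra.Bundles using (CommutativeRing)
open import Data.Nat using (ℕ; NonZero) renaming (_+_ to _+ℕ_; _∸_ to _∸ℕ_)
open import Data.Nat.DivMod using (_mod_)
open import Data.Fin using (Fin; toℕ; splitAt; _≟_) renaming (zero to fzero; suc to fsuc)
open import Data.Sum using (_⊎_; inj₁; inj₂)
open import Data.Product using (Σ; ∃; _×_; _,_)
open import Data.List using (List; []; _∷_)
open import Data.List.Relation.Unary.All using (All)
open import Relation.Nullary using (¬_; yes; no)
open import Relation.Unary using (Pred)

module _ {c ℓ : Level} (R : CommutativeRing c ℓ) where
  open CommutativeRing R

  IsFinite : Set (c ⊔ ℓ)
  IsFinite = Σ ℕ λ k → Σ (Fin k → Carrier) λ e → ∀ x → ∃ λ i → e i ≈ x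

  HasChar2 : Set ℓ
  HasChar2 = (¬ (1# ≈ 0#)) × (1# + 1# ≈ 0#)

  Subset : Set (lsuc (c ⊔ ℓ))
  Subset = Pred Carrier (c ⊔ ℓ)

  record IsIdeal (I : Subset) : Set (c ⊔ ℓ) where
    field
      resp       : ∀ {x y} → x ≈ y → I x → I y
      zero∈      : I 0#
      +-closed   : ∀ {x y} → I x → I y → I (x + y)
      neg-closed : ∀ {x} → I x → I (- x)
      mul-closed : ∀ r {x} → I x → I (r * x)

  _⊆ᵢ_ : Subset → Subset → Set (c ⊔ ℓ)
  I ⊆ᵢ J = ∀ {x} → I x → J x

  record IsMaximalIdeal (M : Subset) : Set (lsuc (c ⊔ ℓ)) where
    field
      ideal   : IsIdeal M
      proper  : ¬ M 1#
      maximal : ∀ I → IsIdeal I → M ⊆ᵢ I → (I ⊆ᵢ M) ⊎ I 1#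

  record IsMinimalIdeal (N : Subset) : Set (lsuc (c ⊔ ℓ)) where
    field
      ideal   : IsIdeal N
      nonzero : ∃ λ x → N x × ¬ (x ≈ 0#)
      minimal : ∀ I → IsIdeal I → I ⊆ᵢ N → (∀ {x} → I x → x ≈ 0#) ⊎ (N ⊆ᵢ I)

  Jacobson : Pred Carrier (lsuc (c ⊔ ℓ))
  Jacobson x = ∀ M → IsMaximalIdeal M → M x

  sumList : List Carrier → Carrier
  sumList []       = 0#
  sumList (y ∷ ys) = y + sumList ys

  Socle : Pred Carrier (lsuc (c ⊔ ℓ))
  Socle x = Σ (List Carrier) λ ys →
              All (λ y → Σ Subset λ N → IsMinimalIdeal N × N y) ys × (sumList ys ≈ x)

  -- R/J(R) ≅ Soc(R) as R-modules, written out: an R-linear map R → Soc(R)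
  -- that is onto Soc(R) and whose kernel is exactly J(R).
  record QuotientJacobson≅Socle : Set (lsuc (c ⊔ ℓ)) where
    field
      f        : Carrier → Carrier
      f-cong   : ∀ {x y} → x ≈ y → f x ≈ f y
      f-into   : ∀ x → Socle (f x)
      f-+      : ∀ x y → f (x + y) ≈ f x + f y
      f-*      : ∀ r x → f (r * x) ≈ r * f x
      ker⇒J    : ∀ x → f x ≈ 0# → Jacobson x
      J⇒ker    : ∀ x → Jacobson x → f x ≈ 0#
      f-onto   : ∀ y → Socle y → ∃ λ x → f x ≈ y

  IsFrobenius : Set (lsuc (c ⊔ ℓ))
  IsFrobenius = IsFinite × QuotientJacobson≅Socle

  Matrix : ℕ → ℕ → Set c
  Matrix m k = Fin m → Fin k → Carrier

  ∑ : ∀ {k} → (Fin k → Carrier) → Carrier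
  ∑ {ℕ.zero}  g = 0#
  ∑ {ℕ.suc k} g = g fzero + ∑ (λ i → g (fsuc i))

  _ᵀ : ∀ {m k} → Matrix m k → Matrix k m
  (M ᵀ) i j = M j i

  _⊕_ : ∀ {m k} → Matrix m k → Matrix m k → Matrix m k
  (M ⊕ N) i j = M i j + N i j

  _⊗_ : ∀ {m k p} → Matrix m k → Matrix k p → Matrix m p
  (M ⊗ N) i j = ∑ (λ t → M i t * N t j)

  I : ∀ m → Matrix m m
  I m i j with i ≟ j
  ... | yes _ = 1#
  ... | no  _ = 0#

  _≋_ : ∀ {m k} → Matrix m k → Matrix m k → Set ℓ
  M ≋ N = ∀ i j → M i j ≈ N i j

  blocks : ∀ {m₁ m₂ k₁ k₂} → Matrix m₁ k₁ → Matrix m₁ k₂ → Matrix m₂ k₁ → Matrix m₂ k₂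
         → Matrix (m₁ +ℕ m₂) (k₁ +ℕ k₂)
  blocks {m₁} {m₂} {k₁} {k₂} P Q S T i j with splitAt m₁ i | splitAt k₁ j
  ... | inj₁ i' | inj₁ j' = P i' j'
  ... | inj₁ i' | inj₂ j' = Q i' j'
  ... | inj₂ i' | inj₁ j' = S i' j'
  ... | inj₂ i' | inj₂ j' = T i' j'

  _∣_ : ∀ {m k₁ k₂} → Matrix m k₁ → Matrix m k₂ → Matrix m (k₁ +ℕ k₂)
  (_∣_ {k₁ = k₁} P Q) i j with splitAt k₁ j
  ... | inj₁ j' = P i j'
  ... | inj₂ j' = Q i j'

  -- circulant: row i is σ^i of row 0, σ the right cyclic shift,
  -- i.e. entry (i , j) equals entry (0 , j - i mod n)
  IsCirculant : ∀ n .{{_ : NonZero n}} → Matrix n n → Set ℓ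
  IsCirculant n M = ∀ i j → M i j ≈ M (0 mod n) ((toℕ j +ℕ (n ∸ℕ toℕ i)) mod n)

  -- reverse circulant: row i is σ^{-i} of row 0,
  -- i.e. entry (i , j) equals entry (0 , j + i mod n)
  IsReverseCirculant : ∀ n .{{_ : NonZero n}} → Matrix n n → Set ℓ
  IsReverseCirculant n M = ∀ i j → M i j ≈ M (0 mod n) ((toℕ j +ℕ toℕ i) mod n)

  IsSymmetric : ∀ {n} → Matrix n n → Set ℓ
  IsSymmetric M = ∀ i j → M i j ≈ M j i

  IsSymmetricCirculant : ∀ n .{{_ : NonZero n}} → Matrix n n → Set ℓ
  IsSymmetricCirculant n M = IsCirculant n M × IsSymmetric M

  Word : ℕ → Set c
  Word N = Fin N → Carrier

  _·_ : ∀ {N} → Word N → Word N → Carrier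
  x · y = ∑ (λ i → x i * y i)

  CodeGeneratedBy : ∀ {m N} → Matrix m N → Pred (Word N) (c ⊔ ℓ)
  CodeGeneratedBy {m} G x = Σ (Fin m → Carrier) λ a → ∀ j → x j ≈ ∑ (λ i → a i * G i j)

  Dual : ∀ {N} {p} → Pred (Word N) p → Pred (Word N) (c ⊔ ℓ ⊔ p)
  Dual 𝒞 y = ∀ x → 𝒞 x → x · y ≈ 0#

  IsSelfDual : ∀ {N} {p} → Pred (Word N) p → Set (c ⊔ ℓ ⊔ p)
  IsSelfDual {N} 𝒞 = ∀ x → (𝒞 x → Dual 𝒞 x) × (Dual 𝒞 x → 𝒞 x)

-- Write G = (I | M) with M = [[A, B+C], [Bᵀ+C, A]].  Reading each circulant as a function of
-- period n on ℤ, circulant matrices commute and a circulant X and a reverse circulant C satisfy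
-- XC = CXᵀ, because a sum over one period is invariant under shifting and reflecting the index.
-- With these relations the off-diagonal blocks of M² cancel in characteristic 2 and the diagonal
-- ones reduce to A² + BBᵀ + C² = I; as M is symmetric, MMᵀ = MᵀM = I = -I.  Over any commutative
-- ring such an M makes (I | M) generate a self-dual code: codewords aG and bG pair to
-- a·b + a·(b MMᵀ) = 0, and a word (y₁ , y₂) orthogonal to all rows has y₁ = -y₂Mᵀ, so it is the
-- codeword y₁G because y₁M = -y₂MᵀM = y₂.

module Submission where

open import Level using (Level; _⊔_)
open import Algebra.Bundles using (CommutativeRing)
open import Data.Nat as ℕ using (ℕ; NonZero; zero; suc; _∸_; s≤s)
import Data.Nat.Properties as ℕₚ
open import Data.Nat.DivMod
  using (_%_; _mod_; [m+n]%n≡m%n; n%n≡0; m<n⇒m%n≡m; m≤n⇒[n∸m]%m≡n%m)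
open import Data.Integer as ℤ using (ℤ; +_; -[1+_]; 0ℤ; _⊖_)
open import Data.Integer.DivMod using (_%ℕ_; n%ℕd<d)
import Data.Integer.Properties as ℤₚ
open import Data.Integer.Tactic.RingSolver using (solve-∀)
open import Data.Fin
  using (Fin; toℕ; fromℕ<; punchIn; splitAt; join; _↑ˡ_; _↑ʳ_; opposite; _≟_)
  renaming (zero to fzero; suc to fsuc)
import Data.Fin.Properties as Finₚ
open import Data.Fin.Permutation using (reverse)
open import Data.Product using (Σ; _×_; _,_)
open import Data.Sum using ([_,_])
open import Data.Empty using (⊥-elim)
open import Relation.Binary.Definitions using (tri<; tri≈; tri>)
open import Function using (_∘_; flip)
open import Relation.Binary.PropositionalEquality as ≡ using (_≡_; _≢_)
open import Relation.Nullary using (yes; no)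
open import Relation.Unary using (Pred)
import Defs

toℤ : ∀ {k} → Fin k → ℤ
toℤ i = + toℕ i

-[1+a]%ℕn : ∀ a n .{{_ : NonZero n}} → -[1+ a ] %ℕ n ≡ (n ∸ suc a % n) % n
-[1+a]%ℕn a n@(suc m) with suc a % n
... | zero  = ≡.sym (n%n≡0 n)
... | suc r = ≡.sym (m<n⇒m%n≡m (s≤s (ℕₚ.m∸n≤m m r)))

[z+n]%ℕn≡z%ℕn : ∀ z n .{{_ : NonZero n}} → (z ℤ.+ + n) %ℕ n ≡ z %ℕ n
[z+n]%ℕn≡z%ℕn (+ a)    n = [m+n]%n≡m%n a n
[z+n]%ℕn≡z%ℕn -[1+ a ] n@(suc m) with ℕₚ.<-cmp (suc a) n
... | tri< a<n _ _ = begin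
  (n ⊖ suc a) %ℕ n           ≡⟨ ≡.cong (_%ℕ n) (ℤₚ.⊖-≥ (ℕₚ.<⇒≤ a<n)) ⟩
  (n ∸ suc a) % n            ≡⟨ ≡.cong (λ k → (n ∸ k) % n) (m<n⇒m%n≡m a<n) ⟨
  (n ∸ suc a % n) % n        ≡⟨ -[1+a]%ℕn a n ⟨
  -[1+ a ] %ℕ n              ∎
  where open ≡.≡-Reasoning
... | tri≈ _ ≡.refl _ = begin
  (n ⊖ n) %ℕ n               ≡⟨ ≡.cong (_%ℕ n) (ℤₚ.⊖-≥ (ℕₚ.≤-refl {n})) ⟩
  (n ∸ n) % n                ≡⟨ ≡.cong (_% n) (ℕₚ.n∸n≡0 n) ⟩
  0                          ≡⟨ n%n≡0 n ⟨
  (n ∸ 0) % n                ≡⟨ ≡.cong (λ k → (n ∸ k) % n) (n%n≡0 n) ⟨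
  (n ∸ n % n) % n            ≡⟨ -[1+a]%ℕn a n ⟨
  -[1+ a ] %ℕ n              ∎
  where open ≡.≡-Reasoning
... | tri> _ _ n<1+a = begin
  (n ⊖ suc a) %ℕ n           ≡⟨ ≡.cong (_%ℕ n) (ℤₚ.⊖-< n<1+a) ⟩
  ℤ.- (+ (suc a ∸ n)) %ℕ n   ≡⟨ ≡.cong (λ k → ℤ.- (+ k) %ℕ n) 1+a∸n ⟩
  -[1+ a ∸ n ] %ℕ n          ≡⟨ -[1+a]%ℕn (a ∸ n) n ⟩
  (n ∸ suc (a ∸ n) % n) % n  ≡⟨ ≡.cong (λ k → (n ∸ k % n) % n) 1+a∸n ⟨
  (n ∸ (suc a ∸ n) % n) % n
    ≡⟨ ≡.cong (λ k → (n ∸ k) % n) (m≤n⇒[n∸m]%m≡n%m (ℕₚ.<⇒≤ n<1+a)) ⟩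
  (n ∸ suc a % n) % n        ≡⟨ -[1+a]%ℕn a n ⟨
  -[1+ a ] %ℕ n              ∎
  where
  open ≡.≡-Reasoning
  1+a∸n : suc a ∸ n ≡ suc (a ∸ n)
  1+a∸n = ℕₚ.+-∸-assoc 1 (ℕₚ.≤-pred n<1+a)

[j+[n∸i]]%n≡[j-i]%ℕn : ∀ j {i} n .{{_ : NonZero n}} → i ℕ.≤ n →
                       (j ℕ.+ (n ∸ i)) % n ≡ (+ j ℤ.- + i) %ℕ n
[j+[n∸i]]%n≡[j-i]%ℕn j {i} n i≤n =
  ≡.trans (≡.cong (_%ℕ n) wrap) ([z+n]%ℕn≡z%ℕn (+ j ℤ.- + i) n)
  where
  open ≡.≡-Reasoning
  reorder : ∀ a b m → a ℤ.+ (m ℤ.- b) ≡ a ℤ.- b ℤ.+ m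
  reorder = solve-∀
  wrap : + (j ℕ.+ (n ∸ i)) ≡ + j ℤ.- + i ℤ.+ + n
  wrap = begin
    + (j ℕ.+ (n ∸ i))        ≡⟨ ℤₚ.pos-+ j (n ∸ i) ⟩
    + j ℤ.+ + (n ∸ i)        ≡⟨ ≡.cong (λ w → + j ℤ.+ w) (ℤₚ.⊖-≥ i≤n) ⟨
    + j ℤ.+ (n ⊖ i)          ≡⟨ ≡.cong (λ w → + j ℤ.+ w) (ℤₚ.m-n≡m⊖n n i) ⟨
    + j ℤ.+ (+ n ℤ.- + i)    ≡⟨ reorder (+ j) (+ i) (+ n) ⟩
    + j ℤ.- + i ℤ.+ + n      ∎

↑ˡ≢↑ʳ : ∀ {m k} (i : Fin m) (j : Fin k) → i ↑ˡ k ≢ m ↑ʳ j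
↑ˡ≢↑ʳ fzero    j ()
↑ˡ≢↑ʳ (fsuc i) j eq = ↑ˡ≢↑ʳ i j (Finₚ.suc-injective eq)

↑-elim : ∀ {p} m k (P : Fin (m ℕ.+ k) → Set p) →
         (∀ i → P (i ↑ˡ k)) → (∀ j → P (m ↑ʳ j)) → ∀ l → P l
↑-elim m k P left right l =
  ≡.subst P (Finₚ.join-splitAt m k l) ([_,_] {C = P ∘ join m k} left right (splitAt m l))

module Matrices {c ℓ : Level} (R : CommutativeRing c ℓ) where

  open CommutativeRing R
  open import Algebra.Properties.Ring ring
    using (+-cancelˡ; +-inverseˡ-unique; +-inverseʳ-unique; -‿involutive; -‿distribˡ-*; -‿distribʳ-*)
  open import Algebra.Properties.Semiring.Sum semiring
    using ( sum; sum-cong-≋; sum-cong-≗; sum-remove; sum-replicate-zero; sum-permute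
          ; *-distribˡ-sum; *-distribʳ-sum)
    renaming (∑-distrib-+ to sum-distrib-+; ∑-comm to sum-comm)
  open import Relation.Binary.Reasoning.Setoid setoid

  infix  4 _≋_
  infixl 6 _⊕_
  infixl 7 _⊗_ _ᵥ⊗_ _⊗ᵥ_ _·_
  infix  5 _∣_
  infixl 8 _ᵀ

  Matrix : ℕ → ℕ → Set c
  Matrix = Defs.Matrix R

  Word : ℕ → Set c
  Word = Defs.Word R

  ∑ : ∀ {k} → (Fin k → Carrier) → Carrier
  ∑ = Defs.∑ R

  _ᵀ : ∀ {m k} → Matrix m k → Matrix k m
  _ᵀ = Defs._ᵀ R

  _⊕_ : ∀ {m k} → Matrix m k → Matrix m k → Matrix m k
  _⊕_ = Defs._⊕_ R

  _⊗_ : ∀ {m k p} → Matrix m k → Matrix k p → Matrix m p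
  _⊗_ = Defs._⊗_ R

  I : ∀ k → Matrix k k
  I = Defs.I R

  _≋_ : ∀ {m k} → Matrix m k → Matrix m k → Set ℓ
  _≋_ = Defs._≋_ R

  _·_ : ∀ {k} → Word k → Word k → Carrier
  _·_ = Defs._·_ R

  _∣_ : ∀ {m k₁ k₂} → Matrix m k₁ → Matrix m k₂ → Matrix m (k₁ ℕ.+ k₂)
  _∣_ = Defs._∣_ R

  blocks : ∀ {m₁ m₂ k₁ k₂} → Matrix m₁ k₁ → Matrix m₁ k₂ → Matrix m₂ k₁ → Matrix m₂ k₂ →
           Matrix (m₁ ℕ.+ m₂) (k₁ ℕ.+ k₂)
  blocks = Defs.blocks R

  CodeGeneratedBy : ∀ {m k} → Matrix m k → Pred (Word k) (c ⊔ ℓ)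
  CodeGeneratedBy = Defs.CodeGeneratedBy R

  Dual : ∀ {k p} → Pred (Word k) p → Pred (Word k) (c ⊔ ℓ ⊔ p)
  Dual = Defs.Dual R

  IsSelfDual : ∀ {k p} → Pred (Word k) p → Set (c ⊔ ℓ ⊔ p)
  IsSelfDual = Defs.IsSelfDual R

  -I : ∀ k → Matrix k k
  -I k i j = - I k i j

  𝟎 : ∀ {m k} → Matrix m k
  𝟎 _ _ = 0#

  _ᵥ⊗_ : ∀ {m k} → Word m → Matrix m k → Word k
  (a ᵥ⊗ M) j = ∑ (λ i → a i * M i j)

  _⊗ᵥ_ : ∀ {m k} → Matrix m k → Word k → Word m
  (M ⊗ᵥ y) i = ∑ (λ j → M i j * y j)

  ∑≡sum : ∀ {k} (f : Fin k → Carrier) → ∑ f ≡ sum f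
  ∑≡sum {zero}  f = ≡.refl
  ∑≡sum {suc k} f = ≡.cong₂ _+_ ≡.refl (∑≡sum (f ∘ fsuc))

  ∑-cong : ∀ {k} {f g : Fin k → Carrier} → (∀ i → f i ≈ g i) → ∑ f ≈ ∑ g
  ∑-cong {f = f} {g} f≈g = begin
    ∑ f   ≡⟨ ∑≡sum f ⟩
    sum f ≈⟨ sum-cong-≋ f≈g ⟩
    sum g ≡⟨ ∑≡sum g ⟨
    ∑ g   ∎

  ∑-distrib-+ : ∀ {k} (f g : Fin k → Carrier) → ∑ (λ i → f i + g i) ≈ ∑ f + ∑ g
  ∑-distrib-+ f g = begin
    ∑ (λ i → f i + g i)   ≡⟨ ∑≡sum (λ i → f i + g i) ⟩
    sum (λ i → f i + g i) ≈⟨ sum-distrib-+ f g ⟩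
    sum f + sum g         ≡⟨ ≡.cong₂ _+_ (∑≡sum f) (∑≡sum g) ⟨
    ∑ f + ∑ g             ∎

  *-distribˡ-∑ : ∀ {k} x (f : Fin k → Carrier) → x * ∑ f ≈ ∑ (λ i → x * f i)
  *-distribˡ-∑ x f = begin
    x * ∑ f               ≡⟨ ≡.cong (x *_) (∑≡sum f) ⟩
    x * sum f             ≈⟨ *-distribˡ-sum x f ⟩
    sum (λ i → x * f i)   ≡⟨ ∑≡sum (λ i → x * f i) ⟨
    ∑ (λ i → x * f i)     ∎

  *-distribʳ-∑ : ∀ {k} x (f : Fin k → Carrier) → ∑ f * x ≈ ∑ (λ i → f i * x)
  *-distribʳ-∑ x f = begin
    ∑ f * x               ≡⟨ ≡.cong (_* x) (∑≡sum f) ⟩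
    sum f * x             ≈⟨ *-distribʳ-sum x f ⟩
    sum (λ i → f i * x)   ≡⟨ ∑≡sum (λ i → f i * x) ⟨
    ∑ (λ i → f i * x)     ∎

  ∑-comm : ∀ {m k} (f : Fin m → Fin k → Carrier) →
           ∑ (λ i → ∑ (λ j → f i j)) ≈ ∑ (λ j → ∑ (λ i → f i j))
  ∑-comm f = begin
    ∑ (λ i → ∑ (λ j → f i j))     ≡⟨ ∑∑≡sum-sum f ⟩
    sum (λ i → sum (λ j → f i j)) ≈⟨ sum-comm f ⟩
    sum (λ j → sum (λ i → f i j)) ≡⟨ ∑∑≡sum-sum (flip f) ⟨
    ∑ (λ j → ∑ (λ i → f i j))     ∎
    where
    ∑∑≡sum-sum : ∀ {m k} (g : Fin m → Fin k → Carrier) →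
                 ∑ (λ i → ∑ (g i)) ≡ sum (λ i → sum (g i))
    ∑∑≡sum-sum g = ≡.trans (∑≡sum (λ i → ∑ (g i))) (sum-cong-≗ (λ i → ∑≡sum (g i)))

  ∑-reverse : ∀ {k} (f : Fin k → Carrier) → ∑ f ≈ ∑ (f ∘ opposite)
  ∑-reverse f = begin
    ∑ f                   ≡⟨ ∑≡sum f ⟩
    sum f                 ≈⟨ sum-permute f reverse ⟩
    sum (f ∘ opposite)    ≡⟨ ∑≡sum (f ∘ opposite) ⟨
    ∑ (f ∘ opposite)      ∎

  ∑-init-last : ∀ k (g : ℕ → Carrier) →
                ∑ {suc k} (g ∘ toℕ) ≈ ∑ {k} (g ∘ toℕ) + g k
  ∑-init-last zero    g = trans (+-identityʳ _) (sym (+-identityˡ _))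
  ∑-init-last (suc k) g = trans (+-congˡ (∑-init-last k (g ∘ suc))) (sym (+-assoc _ _ _))

  ∑-zero : ∀ {k} (f : Fin k → Carrier) → (∀ i → f i ≈ 0#) → ∑ f ≈ 0#
  ∑-zero {k} f f≈0 =
    trans (∑-cong f≈0) (trans (reflexive (∑≡sum {k} (λ _ → 0#))) (sum-replicate-zero k))

  ∑-single : ∀ {k} (f : Fin k → Carrier) j → (∀ i → i ≢ j → f i ≈ 0#) → ∑ f ≈ f j
  ∑-single {suc k} f j off = begin
    ∑ f                         ≡⟨ ∑≡sum f ⟩
    sum f                       ≈⟨ sum-remove {i = j} f ⟩
    f j + sum (f ∘ punchIn j)   ≡⟨ ≡.cong₂ _+_ ≡.refl (∑≡sum {k} (f ∘ punchIn j)) ⟨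
    f j + ∑ (f ∘ punchIn j)     ≈⟨ +-congˡ (∑-zero _ (λ i → off _ (Finₚ.punchInᵢ≢i j i))) ⟩
    f j + 0#                    ≈⟨ +-identityʳ (f j) ⟩
    f j                         ∎

  ∑-neg : ∀ {k} (f : Fin k → Carrier) → ∑ (λ i → - f i) ≈ - ∑ f
  ∑-neg f = +-inverseʳ-unique (∑ f) _ (begin
    ∑ f + ∑ (λ i → - f i)   ≈⟨ ∑-distrib-+ f _ ⟨
    ∑ (λ i → f i + - f i)   ≈⟨ ∑-zero _ (λ i → -‿inverseʳ (f i)) ⟩
    0#                      ∎)

  ∑-splitAt : ∀ m {k} (f : Fin (m ℕ.+ k) → Carrier) →
              ∑ f ≈ ∑ (λ i → f (i ↑ˡ k)) + ∑ (λ j → f (m ↑ʳ j))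
  ∑-splitAt zero    f = sym (+-identityˡ _)
  ∑-splitAt (suc m) f = trans (+-congˡ (∑-splitAt m (f ∘ fsuc))) (sym (+-assoc _ _ _))

  I-diag : ∀ {k} (i : Fin k) → I k i i ≈ 1#
  I-diag i with i ≟ i
  ... | yes _   = refl
  ... | no i≢i  = ⊥-elim (i≢i ≡.refl)

  I-off : ∀ {k} {i j : Fin k} → i ≢ j → I k i j ≈ 0#
  I-off {i = i} {j} i≢j with i ≟ j
  ... | yes i≡j = ⊥-elim (i≢j i≡j)
  ... | no _    = refl

  I-injective : ∀ {m k} (e : Fin m → Fin k) → (∀ {a b} → e a ≡ e b → a ≡ b) →
                ∀ i j → I k (e i) (e j) ≈ I m i j
  I-injective e inj i j with i ≟ j
  ... | yes ≡.refl = I-diag (e i)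
  ... | no i≢j     = I-off (i≢j ∘ inj)

  ᵥ⊗-I : ∀ {k} (a : Word k) j → (a ᵥ⊗ I k) j ≈ a j
  ᵥ⊗-I a j = begin
    ∑ (λ i → a i * I _ i j)
      ≈⟨ ∑-single (λ i → a i * I _ i j) j (λ i i≢j → trans (*-congˡ (I-off i≢j)) (zeroʳ (a i))) ⟩
    a j * I _ j j            ≈⟨ *-congˡ (I-diag j) ⟩
    a j * 1#                 ≈⟨ *-identityʳ (a j) ⟩
    a j                      ∎

  I-⊗ᵥ : ∀ {k} (y : Word k) i → (I k ⊗ᵥ y) i ≈ y i
  I-⊗ᵥ y i = begin
    ∑ (λ j → I _ i j * y j)
      ≈⟨ ∑-single (λ j → I _ i j * y j) i (λ j j≢i → trans (*-congʳ (I-off (j≢i ∘ ≡.sym))) (zeroˡ (y j))) ⟩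
    I _ i i * y i            ≈⟨ *-congʳ (I-diag i) ⟩
    1# * y i                 ≈⟨ *-identityˡ (y i) ⟩
    y i                      ∎

  ᵥ⊗-congˡ : ∀ {m k} {a b : Word m} → (∀ i → a i ≈ b i) → (M : Matrix m k) →
             ∀ j → (a ᵥ⊗ M) j ≈ (b ᵥ⊗ M) j
  ᵥ⊗-congˡ a≈b M j = ∑-cong (λ i → *-congʳ (a≈b i))

  ᵥ⊗-congʳ : ∀ {m k} (a : Word m) {M N : Matrix m k} → M ≋ N → ∀ j → (a ᵥ⊗ M) j ≈ (a ᵥ⊗ N) j
  ᵥ⊗-congʳ a M≋N j = ∑-cong (λ i → *-congˡ (M≋N i j))

  ᵥ⊗-neg : ∀ {m k} (a : Word m) (M : Matrix m k) j → ((λ i → - a i) ᵥ⊗ M) j ≈ - (a ᵥ⊗ M) j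
  ᵥ⊗-neg a M j =
    trans (∑-cong (λ i → sym (-‿distribˡ-* (a i) (M i j)))) (∑-neg (λ i → a i * M i j))

  ᵥ⊗-[-I] : ∀ {k} (a : Word k) j → (a ᵥ⊗ -I k) j ≈ - a j
  ᵥ⊗-[-I] a j = begin
    ∑ (λ i → a i * - I _ i j)    ≈⟨ ∑-cong (λ i → sym (-‿distribʳ-* (a i) (I _ i j))) ⟩
    ∑ (λ i → - (a i * I _ i j))  ≈⟨ ∑-neg (λ i → a i * I _ i j) ⟩
    - (a ᵥ⊗ I _) j               ≈⟨ -‿cong (ᵥ⊗-I a j) ⟩
    - a j                        ∎

  ·-congʳ : ∀ {k} (a : Word k) {b b′ : Word k} → (∀ i → b i ≈ b′ i) → a · b ≈ a · b′
  ·-congʳ a b≈b′ = ∑-cong (λ i → *-congˡ (b≈b′ i))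

  ·-negʳ : ∀ {k} (a b : Word k) → a · (λ i → - b i) ≈ - (a · b)
  ·-negʳ a b = trans (∑-cong (λ i → sym (-‿distribʳ-* (a i) (b i)))) (∑-neg (λ i → a i * b i))

  ·-assoc : ∀ {m k} (a : Word m) (M : Matrix m k) (y : Word k) → (a ᵥ⊗ M) · y ≈ a · (M ⊗ᵥ y)
  ·-assoc a M y = begin
    ∑ (λ j → ∑ (λ i → a i * M i j) * y j)
      ≈⟨ ∑-cong (λ j → *-distribʳ-∑ (y j) (λ i → a i * M i j)) ⟩
    ∑ (λ j → ∑ (λ i → a i * M i j * y j))
      ≈⟨ ∑-comm (λ j i → a i * M i j * y j) ⟩
    ∑ (λ i → ∑ (λ j → a i * M i j * y j))
      ≈⟨ ∑-cong (λ i → ∑-cong (λ j → *-assoc (a i) (M i j) (y j))) ⟩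
    ∑ (λ i → ∑ (λ j → a i * (M i j * y j)))
      ≈⟨ ∑-cong (λ i → *-distribˡ-∑ (a i) (λ j → M i j * y j)) ⟨
    ∑ (λ i → a i * ∑ (λ j → M i j * y j))
      ∎

  ᵥ⊗-assoc : ∀ {m k p} (a : Word m) (M : Matrix m k) (N : Matrix k p) j →
             ((a ᵥ⊗ M) ᵥ⊗ N) j ≈ (a ᵥ⊗ (M ⊗ N)) j
  ᵥ⊗-assoc a M N j = ·-assoc a M (λ t → N t j)

  ⊗ᵥ-ᵀ : ∀ {m k} (M : Matrix m k) (y : Word k) i → (M ⊗ᵥ y) i ≈ (y ᵥ⊗ M ᵀ) i
  ⊗ᵥ-ᵀ M y i = ∑-cong (λ j → *-comm (M i j) (y j))

  ·-splitAt : ∀ m {k} (x y : Word (m ℕ.+ k)) →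
              x · y ≈ (x ∘ (_↑ˡ k)) · (y ∘ (_↑ˡ k)) + (x ∘ (m ↑ʳ_)) · (y ∘ (m ↑ʳ_))
  ·-splitAt m x y = ∑-splitAt m (λ j → x j * y j)

  module _ {m k₁ k₂} (P : Matrix m k₁) (Q : Matrix m k₂) where

    ∣-↑ˡ : ∀ i j → (P ∣ Q) i (j ↑ˡ k₂) ≈ P i j
    ∣-↑ˡ i j rewrite Finₚ.splitAt-↑ˡ k₁ j k₂ = refl

    ∣-↑ʳ : ∀ i j → (P ∣ Q) i (k₁ ↑ʳ j) ≈ Q i j
    ∣-↑ʳ i j rewrite Finₚ.splitAt-↑ʳ k₁ k₂ j = refl

    ᵥ⊗-∣-↑ˡ : ∀ a j → (a ᵥ⊗ (P ∣ Q)) (j ↑ˡ k₂) ≈ (a ᵥ⊗ P) j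
    ᵥ⊗-∣-↑ˡ a j = ∑-cong (λ i → *-congˡ (∣-↑ˡ i j))

    ᵥ⊗-∣-↑ʳ : ∀ a j → (a ᵥ⊗ (P ∣ Q)) (k₁ ↑ʳ j) ≈ (a ᵥ⊗ Q) j
    ᵥ⊗-∣-↑ʳ a j = ∑-cong (λ i → *-congˡ (∣-↑ʳ i j))

    ∣-⊗ᵥ : ∀ y i → ((P ∣ Q) ⊗ᵥ y) i ≈
                  (P ⊗ᵥ (y ∘ (_↑ˡ k₂))) i + (Q ⊗ᵥ (y ∘ (k₁ ↑ʳ_))) i
    ∣-⊗ᵥ y i = trans (·-splitAt k₁ ((P ∣ Q) i) y)
                     (+-cong (∑-cong (λ j → *-congʳ (∣-↑ˡ i j))) (∑-cong (λ j → *-congʳ (∣-↑ʳ i j))))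

  row∈CodeGeneratedBy : ∀ {m k} (G : Matrix m k) i → CodeGeneratedBy G (G i)
  row∈CodeGeneratedBy G i = (λ t → I _ t i) , λ j →
    sym (trans (∑-cong (λ t → *-comm (I _ t i) (G t j))) (ᵥ⊗-I (λ t → G t j) i))

  [I∣M]-codewords-orthogonal : ∀ {N} (M : Matrix N N) → M ⊗ M ᵀ ≋ -I N →
                               ∀ a b → (a ᵥ⊗ (I N ∣ M)) · (b ᵥ⊗ (I N ∣ M)) ≈ 0#
  [I∣M]-codewords-orthogonal {N} M MMᵀ≋-I a b = begin
    (a ᵥ⊗ G) · (b ᵥ⊗ G)
      ≈⟨ ·-splitAt N (a ᵥ⊗ G) (b ᵥ⊗ G) ⟩
    ((a ᵥ⊗ G) ∘ (_↑ˡ N)) · ((b ᵥ⊗ G) ∘ (_↑ˡ N)) + ((a ᵥ⊗ G) ∘ (N ↑ʳ_)) · ((b ᵥ⊗ G) ∘ (N ↑ʳ_))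
      ≈⟨ +-cong (∑-cong (λ q → *-cong (left a q) (left b q))) (∑-cong (λ k → *-cong (right a k) (right b k))) ⟩
    a · b + (a ᵥ⊗ M) · (b ᵥ⊗ M)   ≈⟨ +-congˡ (·-assoc a M (b ᵥ⊗ M)) ⟩
    a · b + a · (M ⊗ᵥ (b ᵥ⊗ M))   ≈⟨ +-congˡ (·-congʳ a M[bM]≈-b) ⟩
    a · b + a · (λ i → - b i)     ≈⟨ +-congˡ (·-negʳ a b) ⟩
    a · b + - (a · b)             ≈⟨ -‿inverseʳ (a · b) ⟩
    0#                            ∎
    where
    G : Matrix N (N ℕ.+ N)
    G = I N ∣ M
    left : ∀ a q → (a ᵥ⊗ G) (q ↑ˡ N) ≈ a q
    left a q = trans (ᵥ⊗-∣-↑ˡ (I N) M a q) (ᵥ⊗-I a q)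
    right : ∀ a k → (a ᵥ⊗ G) (N ↑ʳ k) ≈ (a ᵥ⊗ M) k
    right a k = ᵥ⊗-∣-↑ʳ (I N) M a k
    M[bM]≈-b : ∀ i → (M ⊗ᵥ (b ᵥ⊗ M)) i ≈ - b i
    M[bM]≈-b i = begin
      (M ⊗ᵥ (b ᵥ⊗ M)) i        ≈⟨ ⊗ᵥ-ᵀ M (b ᵥ⊗ M) i ⟩
      ((b ᵥ⊗ M) ᵥ⊗ M ᵀ) i      ≈⟨ ᵥ⊗-assoc b M (M ᵀ) i ⟩
      (b ᵥ⊗ (M ⊗ M ᵀ)) i       ≈⟨ ᵥ⊗-congʳ b MMᵀ≋-I i ⟩
      (b ᵥ⊗ -I N) i            ≈⟨ ᵥ⊗-[-I] b i ⟩
      - b i                    ∎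

  Dual-[I∣M]⊆Code : ∀ {N} (M : Matrix N N) → M ᵀ ⊗ M ≋ -I N →
                    ∀ y → Dual (CodeGeneratedBy (I N ∣ M)) y → CodeGeneratedBy (I N ∣ M) y
  Dual-[I∣M]⊆Code {N} M MᵀM≋-I y y⊥ =
    y₁ , ↑-elim N N (λ j → y j ≈ (y₁ ᵥ⊗ G) j) left right
    where
    G : Matrix N (N ℕ.+ N)
    G = I N ∣ M
    y₁ y₂ : Word N
    y₁ q = y (q ↑ˡ N)
    y₂ k = y (N ↑ʳ k)
    y₁≈-My₂ : ∀ i → y₁ i ≈ - (M ⊗ᵥ y₂) i
    y₁≈-My₂ i = +-inverseˡ-unique _ _ (begin
      y₁ i + (M ⊗ᵥ y₂) i            ≈⟨ +-congʳ (I-⊗ᵥ y₁ i) ⟨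
      (I N ⊗ᵥ y₁) i + (M ⊗ᵥ y₂) i   ≈⟨ ∣-⊗ᵥ (I N) M y i ⟨
      G i · y                       ≈⟨ y⊥ (G i) (row∈CodeGeneratedBy G i) ⟩
      0#                            ∎)
    left : ∀ q → y (q ↑ˡ N) ≈ (y₁ ᵥ⊗ G) (q ↑ˡ N)
    left q = sym (trans (ᵥ⊗-∣-↑ˡ (I N) M y₁ q) (ᵥ⊗-I y₁ q))
    right : ∀ k → y (N ↑ʳ k) ≈ (y₁ ᵥ⊗ G) (N ↑ʳ k)
    right k = sym (begin
      (y₁ ᵥ⊗ G) (N ↑ʳ k)                   ≈⟨ ᵥ⊗-∣-↑ʳ (I N) M y₁ k ⟩
      (y₁ ᵥ⊗ M) k                          ≈⟨ ᵥ⊗-congˡ y₁≈-My₂ M k ⟩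
      ((λ i → - (M ⊗ᵥ y₂) i) ᵥ⊗ M) k       ≈⟨ ᵥ⊗-neg (M ⊗ᵥ y₂) M k ⟩
      - ((M ⊗ᵥ y₂) ᵥ⊗ M) k                 ≈⟨ -‿cong (ᵥ⊗-congˡ (⊗ᵥ-ᵀ M y₂) M k) ⟩
      - ((y₂ ᵥ⊗ M ᵀ) ᵥ⊗ M) k               ≈⟨ -‿cong (ᵥ⊗-assoc y₂ (M ᵀ) M k) ⟩
      - (y₂ ᵥ⊗ (M ᵀ ⊗ M)) k                ≈⟨ -‿cong (ᵥ⊗-congʳ y₂ MᵀM≋-I k) ⟩
      - (y₂ ᵥ⊗ -I N) k                     ≈⟨ -‿cong (ᵥ⊗-[-I] y₂ k) ⟩
      - - y₂ k                             ≈⟨ -‿involutive (y₂ k) ⟩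
      y₂ k                                 ∎)

  -- Over a commutative ring MMᵀ = -I implies MᵀM = -I only through determinants, so both are assumed.
  [I∣M]-selfDual : ∀ {N} (M : Matrix N N) → M ⊗ M ᵀ ≋ -I N → M ᵀ ⊗ M ≋ -I N →
                   IsSelfDual (CodeGeneratedBy (I N ∣ M))
  [I∣M]-selfDual {N} M MMᵀ≋-I MᵀM≋-I y = code⊆dual , Dual-[I∣M]⊆Code M MᵀM≋-I y
    where
    code⊆dual : CodeGeneratedBy (I N ∣ M) y → Dual (CodeGeneratedBy (I N ∣ M)) y
    code⊆dual (b , y≈bG) x (a , x≈aG) =
      trans (∑-cong (λ j → *-cong (x≈aG j) (y≈bG j))) ([I∣M]-codewords-orthogonal M MMᵀ≋-I a b)

  ⊗-congˡ : ∀ {m k p} {X X′ : Matrix m k} → X ≋ X′ → (Y : Matrix k p) →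
            X ⊗ Y ≋ X′ ⊗ Y
  ⊗-congˡ X≋X′ Y i j = ∑-cong (λ t → *-congʳ (X≋X′ i t))

  ⊗-congʳ : ∀ {m k p} (X : Matrix m k) {Y Y′ : Matrix k p} → Y ≋ Y′ → X ⊗ Y ≋ X ⊗ Y′
  ⊗-congʳ X Y≋Y′ i j = ∑-cong (λ t → *-congˡ (Y≋Y′ t j))

  ⊗-distribˡ-⊕ : ∀ {m k p} (X : Matrix m k) (Y Z : Matrix k p) →
                 X ⊗ (Y ⊕ Z) ≋ X ⊗ Y ⊕ X ⊗ Z
  ⊗-distribˡ-⊕ X Y Z i j = trans (∑-cong (λ t → distribˡ (X i t) (Y t j) (Z t j)))
                                 (∑-distrib-+ (λ t → X i t * Y t j) (λ t → X i t * Z t j))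

  ⊗-distribʳ-⊕ : ∀ {m k p} (X : Matrix k p) (Y Z : Matrix m k) →
                 (Y ⊕ Z) ⊗ X ≋ Y ⊗ X ⊕ Z ⊗ X
  ⊗-distribʳ-⊕ X Y Z i j = trans (∑-cong (λ t → distribʳ (X t j) (Y i t) (Z i t)))
                                 (∑-distrib-+ (λ t → Y i t * X t j) (λ t → Z i t * X t j))

  ⊗-expand : ∀ {m k p} (X Y : Matrix m k) (Z W : Matrix k p) →
             (X ⊕ Y) ⊗ (Z ⊕ W) ≋ (X ⊗ Z ⊕ X ⊗ W) ⊕ (Y ⊗ Z ⊕ Y ⊗ W)
  ⊗-expand X Y Z W i j = trans (⊗-distribʳ-⊕ (Z ⊕ W) X Y i j)
                               (+-cong (⊗-distribˡ-⊕ X Z W i j) (⊗-distribˡ-⊕ Y Z W i j))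

  ⊗-comm-⊕ : ∀ {k} {X Y Z : Matrix k k} → X ⊗ Y ≋ Y ⊗ X → X ⊗ Z ≋ Z ⊗ X →
             X ⊗ (Y ⊕ Z) ≋ (Y ⊕ Z) ⊗ X
  ⊗-comm-⊕ {X = X} {Y} {Z} XY≋YX XZ≋ZX i j = begin
    (X ⊗ (Y ⊕ Z)) i j           ≈⟨ ⊗-distribˡ-⊕ X Y Z i j ⟩
    (X ⊗ Y) i j + (X ⊗ Z) i j   ≈⟨ +-cong (XY≋YX i j) (XZ≋ZX i j) ⟩
    (Y ⊗ X) i j + (Z ⊗ X) i j   ≈⟨ ⊗-distribʳ-⊕ X Y Z i j ⟨
    ((Y ⊕ Z) ⊗ X) i j           ∎

  module _ {m₁ m₂ k₁ k₂}
           (P : Matrix m₁ k₁) (Q : Matrix m₁ k₂) (S : Matrix m₂ k₁) (T : Matrix m₂ k₂) where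

    blocks-↑ˡ↑ˡ : ∀ i j → blocks P Q S T (i ↑ˡ m₂) (j ↑ˡ k₂) ≈ P i j
    blocks-↑ˡ↑ˡ i j rewrite Finₚ.splitAt-↑ˡ m₁ i m₂ | Finₚ.splitAt-↑ˡ k₁ j k₂ = refl

    blocks-↑ˡ↑ʳ : ∀ i j → blocks P Q S T (i ↑ˡ m₂) (k₁ ↑ʳ j) ≈ Q i j
    blocks-↑ˡ↑ʳ i j rewrite Finₚ.splitAt-↑ˡ m₁ i m₂ | Finₚ.splitAt-↑ʳ k₁ k₂ j = refl

    blocks-↑ʳ↑ˡ : ∀ i j → blocks P Q S T (m₁ ↑ʳ i) (j ↑ˡ k₂) ≈ S i j
    blocks-↑ʳ↑ˡ i j rewrite Finₚ.splitAt-↑ʳ m₁ m₂ i | Finₚ.splitAt-↑ˡ k₁ j k₂ = refl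

    blocks-↑ʳ↑ʳ : ∀ i j → blocks P Q S T (m₁ ↑ʳ i) (k₁ ↑ʳ j) ≈ T i j
    blocks-↑ʳ↑ʳ i j rewrite Finₚ.splitAt-↑ʳ m₁ m₂ i | Finₚ.splitAt-↑ʳ k₁ k₂ j = refl

  ≋-byBlocks : ∀ {m₁ m₂ k₁ k₂} {X Y : Matrix (m₁ ℕ.+ m₂) (k₁ ℕ.+ k₂)} →
               (∀ i j → X (i ↑ˡ m₂) (j ↑ˡ k₂) ≈ Y (i ↑ˡ m₂) (j ↑ˡ k₂)) →
               (∀ i j → X (i ↑ˡ m₂) (k₁ ↑ʳ j) ≈ Y (i ↑ˡ m₂) (k₁ ↑ʳ j)) →
               (∀ i j → X (m₁ ↑ʳ i) (j ↑ˡ k₂) ≈ Y (m₁ ↑ʳ i) (j ↑ˡ k₂)) →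
               (∀ i j → X (m₁ ↑ʳ i) (k₁ ↑ʳ j) ≈ Y (m₁ ↑ʳ i) (k₁ ↑ʳ j)) → X ≋ Y
  ≋-byBlocks {m₁} {m₂} {k₁} {k₂} {X} {Y} upper-left upper-right lower-left lower-right =
    ↑-elim m₁ m₂ (λ p → ∀ q → X p q ≈ Y p q)
      (λ i → ↑-elim k₁ k₂ (λ q → X (i ↑ˡ m₂) q ≈ Y (i ↑ˡ m₂) q) (upper-left i) (upper-right i))
      (λ i → ↑-elim k₁ k₂ (λ q → X (m₁ ↑ʳ i) q ≈ Y (m₁ ↑ʳ i) q) (lower-left i) (lower-right i))

  blocks-cong : ∀ {m₁ m₂ k₁ k₂} {P P′ : Matrix m₁ k₁} {Q Q′ : Matrix m₁ k₂}
                {S S′ : Matrix m₂ k₁} {T T′ : Matrix m₂ k₂} →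
                P ≋ P′ → Q ≋ Q′ → S ≋ S′ → T ≋ T′ → blocks P Q S T ≋ blocks P′ Q′ S′ T′
  blocks-cong {P = P} {P′} {Q} {Q′} {S} {S′} {T} {T′} P≋P′ Q≋Q′ S≋S′ T≋T′ = ≋-byBlocks
    (λ i j → trans (blocks-↑ˡ↑ˡ P Q S T i j) (trans (P≋P′ i j) (sym (blocks-↑ˡ↑ˡ P′ Q′ S′ T′ i j))))
    (λ i j → trans (blocks-↑ˡ↑ʳ P Q S T i j) (trans (Q≋Q′ i j) (sym (blocks-↑ˡ↑ʳ P′ Q′ S′ T′ i j))))
    (λ i j → trans (blocks-↑ʳ↑ˡ P Q S T i j) (trans (S≋S′ i j) (sym (blocks-↑ʳ↑ˡ P′ Q′ S′ T′ i j))))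
    (λ i j → trans (blocks-↑ʳ↑ʳ P Q S T i j) (trans (T≋T′ i j) (sym (blocks-↑ʳ↑ʳ P′ Q′ S′ T′ i j))))

  blocks-symmetric : ∀ {m k} {P : Matrix m m} {Q : Matrix m k} {S : Matrix k m} {T : Matrix k k} →
                     P ≋ P ᵀ → S ≋ Q ᵀ → T ≋ T ᵀ → blocks P Q S T ≋ blocks P Q S T ᵀ
  blocks-symmetric {P = P} {Q} {S} {T} P≋Pᵀ S≋Qᵀ T≋Tᵀ = ≋-byBlocks
    (λ i j → trans (blocks-↑ˡ↑ˡ P Q S T i j) (trans (P≋Pᵀ i j) (sym (blocks-↑ˡ↑ˡ P Q S T j i))))
    (λ i j → trans (blocks-↑ˡ↑ʳ P Q S T i j) (trans (sym (S≋Qᵀ j i)) (sym (blocks-↑ʳ↑ˡ P Q S T j i))))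
    (λ i j → trans (blocks-↑ʳ↑ˡ P Q S T i j) (trans (S≋Qᵀ i j) (sym (blocks-↑ˡ↑ʳ P Q S T j i))))
    (λ i j → trans (blocks-↑ʳ↑ʳ P Q S T i j) (trans (T≋Tᵀ i j) (sym (blocks-↑ʳ↑ʳ P Q S T j i))))

  I-blocks : ∀ m k → I (m ℕ.+ k) ≋ blocks (I m) 𝟎 𝟎 (I k)
  I-blocks m k = ≋-byBlocks
    (λ i j → trans (I-injective (_↑ˡ k) (Finₚ.↑ˡ-injective k _ _) i j) (sym (blocks-↑ˡ↑ˡ (I m) 𝟎 𝟎 (I k) i j)))
    (λ i j → trans (I-off (↑ˡ≢↑ʳ i j)) (sym (blocks-↑ˡ↑ʳ (I m) 𝟎 𝟎 (I k) i j)))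
    (λ i j → trans (I-off (↑ˡ≢↑ʳ j i ∘ ≡.sym)) (sym (blocks-↑ʳ↑ˡ (I m) 𝟎 𝟎 (I k) i j)))
    (λ i j → trans (I-injective (m ↑ʳ_) (Finₚ.↑ʳ-injective m _ _) i j) (sym (blocks-↑ʳ↑ʳ (I m) 𝟎 𝟎 (I k) i j)))

  ⊗-blocks : ∀ {m₁ m₂ k₁ k₂ p₁ p₂}
             (P : Matrix m₁ k₁) (Q : Matrix m₁ k₂) (S : Matrix m₂ k₁) (T : Matrix m₂ k₂)
             (P′ : Matrix k₁ p₁) (Q′ : Matrix k₁ p₂) (S′ : Matrix k₂ p₁) (T′ : Matrix k₂ p₂) →
             blocks P Q S T ⊗ blocks P′ Q′ S′ T′ ≋
             blocks (P ⊗ P′ ⊕ Q ⊗ S′) (P ⊗ Q′ ⊕ Q ⊗ T′) (S ⊗ P′ ⊕ T ⊗ S′) (S ⊗ Q′ ⊕ T ⊗ T′)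
  ⊗-blocks {m₁} {m₂} {k₁} {k₂} {p₁} {p₂} P Q S T P′ Q′ S′ T′ = ≋-byBlocks
    (λ i j → trans (split (i ↑ˡ m₂) (j ↑ˡ p₂)) (trans
      (+-cong (∑-cong (λ t → *-cong (blocks-↑ˡ↑ˡ P Q S T i t) (blocks-↑ˡ↑ˡ P′ Q′ S′ T′ t j)))
              (∑-cong (λ t → *-cong (blocks-↑ˡ↑ʳ P Q S T i t) (blocks-↑ʳ↑ˡ P′ Q′ S′ T′ t j))))
      (sym (blocks-↑ˡ↑ˡ UL UR LL LR i j))))
    (λ i j → trans (split (i ↑ˡ m₂) (p₁ ↑ʳ j)) (trans
      (+-cong (∑-cong (λ t → *-cong (blocks-↑ˡ↑ˡ P Q S T i t) (blocks-↑ˡ↑ʳ P′ Q′ S′ T′ t j)))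
              (∑-cong (λ t → *-cong (blocks-↑ˡ↑ʳ P Q S T i t) (blocks-↑ʳ↑ʳ P′ Q′ S′ T′ t j))))
      (sym (blocks-↑ˡ↑ʳ UL UR LL LR i j))))
    (λ i j → trans (split (m₁ ↑ʳ i) (j ↑ˡ p₂)) (trans
      (+-cong (∑-cong (λ t → *-cong (blocks-↑ʳ↑ˡ P Q S T i t) (blocks-↑ˡ↑ˡ P′ Q′ S′ T′ t j)))
              (∑-cong (λ t → *-cong (blocks-↑ʳ↑ʳ P Q S T i t) (blocks-↑ʳ↑ˡ P′ Q′ S′ T′ t j))))
      (sym (blocks-↑ʳ↑ˡ UL UR LL LR i j))))
    (λ i j → trans (split (m₁ ↑ʳ i) (p₁ ↑ʳ j)) (trans
      (+-cong (∑-cong (λ t → *-cong (blocks-↑ʳ↑ˡ P Q S T i t) (blocks-↑ˡ↑ʳ P′ Q′ S′ T′ t j)))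
              (∑-cong (λ t → *-cong (blocks-↑ʳ↑ʳ P Q S T i t) (blocks-↑ʳ↑ʳ P′ Q′ S′ T′ t j))))
      (sym (blocks-↑ʳ↑ʳ UL UR LL LR i j))))
    where
    X : Matrix (m₁ ℕ.+ m₂) (k₁ ℕ.+ k₂)
    X = blocks P Q S T
    Y : Matrix (k₁ ℕ.+ k₂) (p₁ ℕ.+ p₂)
    Y = blocks P′ Q′ S′ T′
    UL : Matrix m₁ p₁
    UL = P ⊗ P′ ⊕ Q ⊗ S′
    UR : Matrix m₁ p₂
    UR = P ⊗ Q′ ⊕ Q ⊗ T′
    LL : Matrix m₂ p₁
    LL = S ⊗ P′ ⊕ T ⊗ S′
    LR : Matrix m₂ p₂
    LR = S ⊗ Q′ ⊕ T ⊗ T′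
    split : ∀ r s → (X ⊗ Y) r s ≈
                    ∑ (λ t → X r (t ↑ˡ k₂) * Y (t ↑ˡ k₂) s) + ∑ (λ t → X r (k₁ ↑ʳ t) * Y (k₁ ↑ʳ t) s)
    split r s = ∑-splitAt k₁ (λ t → X r t * Y t s)

  module _ (n : ℕ) .{{_ : NonZero n}} where

    Periodic : (ℤ → Carrier) → Set ℓ
    Periodic h = ∀ z → h (z ℤ.+ + n) ≈ h z

    ∑ℤₙ : (ℤ → Carrier) → Carrier
    ∑ℤₙ h = ∑ (λ (t : Fin n) → h (toℤ t))

    ∑ℤₙ-cong : ∀ {f g} → (∀ z → f z ≈ g z) → ∑ℤₙ f ≈ ∑ℤₙ g
    ∑ℤₙ-cong f≈g = ∑-cong (λ (t : Fin n) → f≈g (toℤ t))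

    periodic-+ˡ : ∀ {h} → Periodic h → ∀ s → Periodic (λ z → h (s ℤ.+ z))
    periodic-+ˡ {h} h-per s z =
      trans (reflexive (≡.cong h (≡.sym (ℤₚ.+-assoc s z (+ n))))) (h-per (s ℤ.+ z))

    periodic-+ʳ : ∀ {h} → Periodic h → ∀ s → Periodic (λ z → h (z ℤ.+ s))
    periodic-+ʳ {h} h-per s z = trans (reflexive (≡.cong h (swap z s (+ n)))) (h-per (z ℤ.+ s))
      where
      swap : ∀ z s m → z ℤ.+ m ℤ.+ s ≡ z ℤ.+ s ℤ.+ m
      swap = solve-∀

    periodic-reflect : ∀ {h} → Periodic h → ∀ s → Periodic (λ z → h (s ℤ.- z))
    periodic-reflect {h} h-per s z =
      sym (trans (reflexive (≡.cong h (unshift s z (+ n)))) (h-per (s ℤ.- (z ℤ.+ + n))))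
      where
      unshift : ∀ s z m → s ℤ.- z ≡ s ℤ.- (z ℤ.+ m) ℤ.+ m
      unshift = solve-∀

    periodic-* : ∀ {f g} → Periodic f → Periodic g → Periodic (λ z → f z * g z)
    periodic-* f-per g-per z = *-cong (f-per z) (g-per z)

    -- Adding h 0 to the left side and h n to the right side both give the sum over 0 … n.
    ∑ℤₙ-shift₁ : ∀ {h} → Periodic h → ∑ℤₙ (λ z → h (+ 1 ℤ.+ z)) ≈ ∑ℤₙ h
    ∑ℤₙ-shift₁ {h} h-per = +-cancelˡ (h 0ℤ) _ _ (begin
      h 0ℤ + ∑ℤₙ (λ z → h (+ 1 ℤ.+ z))  ≈⟨ ∑-init-last n (λ k → h (+ k)) ⟩
      ∑ℤₙ h + h (+ n)                   ≈⟨ +-congˡ (h-per 0ℤ) ⟩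
      ∑ℤₙ h + h 0ℤ                      ≈⟨ +-comm _ _ ⟩
      h 0ℤ + ∑ℤₙ h                      ∎)

    ∑ℤₙ-shiftℕ : ∀ {h} → Periodic h → ∀ k → ∑ℤₙ (λ z → h (+ k ℤ.+ z)) ≈ ∑ℤₙ h
    ∑ℤₙ-shiftℕ h-per zero    = refl
    ∑ℤₙ-shiftℕ h-per (suc k) = trans (∑ℤₙ-shiftℕ (periodic-+ˡ h-per (+ 1)) k) (∑ℤₙ-shift₁ h-per)

    ∑ℤₙ-shift : ∀ {h} → Periodic h → ∀ s → ∑ℤₙ (λ z → h (s ℤ.+ z)) ≈ ∑ℤₙ h
    ∑ℤₙ-shift h-per (+ k)        = ∑ℤₙ-shiftℕ h-per k
    ∑ℤₙ-shift {h} h-per -[1+ k ] = begin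
      ∑ℤₙ (λ z → h (-[1+ k ] ℤ.+ z))
        ≈⟨ ∑ℤₙ-shiftℕ (periodic-+ˡ h-per -[1+ k ]) (suc k) ⟨
      ∑ℤₙ (λ z → h (-[1+ k ] ℤ.+ (+ suc k ℤ.+ z)))
        ≈⟨ ∑ℤₙ-cong (λ z → reflexive (≡.cong h (cancel (+ suc k) z))) ⟩
      ∑ℤₙ h
        ∎
      where
      cancel : ∀ m z → ℤ.- m ℤ.+ (m ℤ.+ z) ≡ z
      cancel = solve-∀

    ∑ℤₙ-reflect : ∀ {h} → Periodic h → ∑ℤₙ (λ z → h (ℤ.- z)) ≈ ∑ℤₙ h
    ∑ℤₙ-reflect {h} h-per = begin
      ∑ℤₙ (λ z → h (ℤ.- z))
        ≈⟨ ∑-reverse (λ (t : Fin n) → h (ℤ.- toℤ t)) ⟩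
      ∑ (λ (t : Fin n) → h (ℤ.- toℤ (opposite t)))
        ≈⟨ ∑-cong (λ t → sym (opposite-shift (toℕ t) (Finₚ.toℕ<n t) (Finₚ.opposite-prop t))) ⟩
      ∑ℤₙ (λ z → h (+ 1 ℤ.+ z))
        ≈⟨ ∑ℤₙ-shift₁ h-per ⟩
      ∑ℤₙ h
        ∎
      where
      opposite-shift : ∀ k {o} → k ℕ.< n → o ≡ n ∸ suc k → h (+ suc k) ≈ h (ℤ.- + o)
      opposite-shift k k<n ≡.refl = begin
        h (+ suc k)                          ≡⟨ ≡.cong h (unshift (+ suc k) (+ n)) ⟩
        h ((+ suc k ℤ.- + n) ℤ.+ + n)        ≈⟨ h-per _ ⟩
        h (+ suc k ℤ.- + n)                  ≡⟨ ≡.cong h (ℤₚ.m-n≡m⊖n (suc k) n) ⟩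
        h (suc k ⊖ n)                        ≡⟨ ≡.cong h (ℤₚ.⊖-swap (suc k) n) ⟩
        h (ℤ.- (n ⊖ suc k))                  ≡⟨ ≡.cong (h ∘ ℤ.-_) (ℤₚ.⊖-≥ k<n) ⟩
        h (ℤ.- + (n ∸ suc k))                ∎
        where
        unshift : ∀ a m → a ≡ (a ℤ.- m) ℤ.+ m
        unshift = solve-∀

    ∑ℤₙ-reflect-at : ∀ {h} → Periodic h → ∀ s → ∑ℤₙ (λ z → h (s ℤ.- z)) ≈ ∑ℤₙ h
    ∑ℤₙ-reflect-at h-per s = trans (∑ℤₙ-reflect (periodic-+ˡ h-per s)) (∑ℤₙ-shift h-per s)

    -- Entries as a function of j - i (resp. i + j) of period n on ℤ, so that index arithmetic
    -- modulo n becomes ring arithmetic in ℤ.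
    Circulant : Matrix n n → Set (c ⊔ ℓ)
    Circulant X = Σ (ℤ → Carrier) λ x → Periodic x × (∀ i j → X i j ≈ x (toℤ j ℤ.- toℤ i))

    ReverseCirculant : Matrix n n → Set (c ⊔ ℓ)
    ReverseCirculant X = Σ (ℤ → Carrier) λ x → Periodic x × (∀ i j → X i j ≈ x (toℤ i ℤ.+ toℤ j))

    firstRow : Matrix n n → ℤ → Carrier
    firstRow X z = X (0 mod n) (fromℕ< (n%ℕd<d z n))

    firstRow-periodic : ∀ X → Periodic (firstRow X)
    firstRow-periodic X z =
      reflexive (≡.cong (X (0 mod n)) (Finₚ.fromℕ<-cong _ _ ([z+n]%ℕn≡z%ℕn z n) _ _))

    IsCirculant⇒Circulant : ∀ {X} → Defs.IsCirculant R n X → Circulant X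
    IsCirculant⇒Circulant {X} X-circ = firstRow X , firstRow-periodic X , λ i j →
      trans (X-circ i j) (reflexive (≡.cong (X (0 mod n))
        (Finₚ.fromℕ<-cong _ _ ([j+[n∸i]]%n≡[j-i]%ℕn (toℕ j) n (ℕₚ.<⇒≤ (Finₚ.toℕ<n i))) _ _)))

    IsReverseCirculant⇒ReverseCirculant : ∀ {X} → Defs.IsReverseCirculant R n X → ReverseCirculant X
    IsReverseCirculant⇒ReverseCirculant {X} X-rev = firstRow X , firstRow-periodic X , λ i j →
      trans (X-rev i j) (reflexive (≡.cong (X (0 mod n))
        (Finₚ.fromℕ<-cong _ _ (≡.cong (_% n) (ℕₚ.+-comm (toℕ j) (toℕ i))) _ _)))

    circulant-ᵀ : ∀ {X} → Circulant X → Circulant (X ᵀ)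
    circulant-ᵀ (x , x-per , X≈x) = (λ z → x (0ℤ ℤ.- z)) , periodic-reflect x-per 0ℤ , λ i j →
      trans (X≈x j i) (reflexive (≡.cong x (negate (toℤ i) (toℤ j))))
      where
      negate : ∀ a b → a ℤ.- b ≡ 0ℤ ℤ.- (b ℤ.- a)
      negate = solve-∀

    reverseCirculant-symmetric : ∀ {X} → ReverseCirculant X → X ≋ X ᵀ
    reverseCirculant-symmetric (x , _ , X≈x) i j =
      trans (X≈x i j) (trans (reflexive (≡.cong x (ℤₚ.+-comm (toℤ i) (toℤ j)))) (sym (X≈x j i)))

    circulant-comm : ∀ {X Y} → Circulant X → Circulant Y → X ⊗ Y ≋ Y ⊗ X
    circulant-comm {X} {Y} (x , x-per , X≈x) (y , y-per , Y≈y) i j = begin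
      (X ⊗ Y) i j                       ≈⟨ ∑-cong (λ t → *-cong (X≈x i t) (Y≈y t j)) ⟩
      ∑ℤₙ F                             ≈⟨ ∑ℤₙ-reflect-at F-per (i′ ℤ.+ j′) ⟨
      ∑ℤₙ (λ z → F (i′ ℤ.+ j′ ℤ.- z))   ≈⟨ ∑ℤₙ-cong F-reflected ⟩
      ∑ℤₙ G                             ≈⟨ ∑-cong (λ t → *-cong (Y≈y i t) (X≈x t j)) ⟨
      (Y ⊗ X) i j                       ∎
      where
      i′ j′ : ℤ
      i′ = toℤ i
      j′ = toℤ j
      F G : ℤ → Carrier
      F z = x (z ℤ.- i′) * y (j′ ℤ.- z)
      G z = y (z ℤ.- i′) * x (j′ ℤ.- z)
      F-per : Periodic F
      F-per = periodic-* (periodic-+ʳ x-per (ℤ.- i′)) (periodic-reflect y-per j′)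
      F-reflected : ∀ z → F (i′ ℤ.+ j′ ℤ.- z) ≈ G z
      F-reflected z =
        trans (*-cong (reflexive (≡.cong x (left i′ j′ z))) (reflexive (≡.cong y (right i′ j′ z)))) (*-comm _ _)
        where
        left : ∀ a b z → a ℤ.+ b ℤ.- z ℤ.- a ≡ b ℤ.- z
        left = solve-∀
        right : ∀ a b z → b ℤ.- (a ℤ.+ b ℤ.- z) ≡ z ℤ.- a
        right = solve-∀

    circulant-reverseCirculant : ∀ {X Y} → Circulant X → ReverseCirculant Y → X ⊗ Y ≋ Y ⊗ X ᵀ
    circulant-reverseCirculant {X} {Y} (x , x-per , X≈x) (y , y-per , Y≈y) i j = begin
      (X ⊗ Y) i j                       ≈⟨ ∑-cong (λ t → *-cong (X≈x i t) (Y≈y t j)) ⟩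
      ∑ℤₙ F                             ≈⟨ ∑ℤₙ-shift F-per (i′ ℤ.- j′) ⟨
      ∑ℤₙ (λ z → F (i′ ℤ.- j′ ℤ.+ z))   ≈⟨ ∑ℤₙ-cong F-shifted ⟩
      ∑ℤₙ G                             ≈⟨ ∑-cong (λ t → *-cong (Y≈y i t) (X≈x j t)) ⟨
      (Y ⊗ X ᵀ) i j                     ∎
      where
      i′ j′ : ℤ
      i′ = toℤ i
      j′ = toℤ j
      F G : ℤ → Carrier
      F z = x (z ℤ.- i′) * y (z ℤ.+ j′)
      G z = y (i′ ℤ.+ z) * x (z ℤ.- j′)
      F-per : Periodic F
      F-per = periodic-* (periodic-+ʳ x-per (ℤ.- i′)) (periodic-+ʳ y-per j′)
      F-shifted : ∀ z → F (i′ ℤ.- j′ ℤ.+ z) ≈ G z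
      F-shifted z =
        trans (*-cong (reflexive (≡.cong x (left i′ j′ z))) (reflexive (≡.cong y (right i′ j′ z)))) (*-comm _ _)
        where
        left : ∀ a b z → a ℤ.- b ℤ.+ z ℤ.- a ≡ z ℤ.- b
        left = solve-∀
        right : ∀ a b z → a ℤ.- b ℤ.+ z ℤ.+ b ≡ a ℤ.+ z
        right = solve-∀

  module Characteristic2 (1+1≈0 : 1# + 1# ≈ 0#) where

    x+x≈0 : ∀ x → x + x ≈ 0#
    x+x≈0 x = begin
      x + x               ≈⟨ +-cong (*-identityʳ x) (*-identityʳ x) ⟨
      x * 1# + x * 1#     ≈⟨ distribˡ x 1# 1# ⟨
      x * (1# + 1#)       ≈⟨ *-congˡ 1+1≈0 ⟩
      x * 0#              ≈⟨ zeroʳ x ⟩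
      0#                  ∎

    -x≈x : ∀ x → - x ≈ x
    -x≈x x = sym (+-inverseʳ-unique x x (x+x≈0 x))

    ≈⇒+≈0 : ∀ {x y} → x ≈ y → x + y ≈ 0#
    ≈⇒+≈0 {x} {y} x≈y = trans (+-congʳ x≈y) (x+x≈0 y)

    +-cancel-middle : ∀ p {q r} s → q ≈ r → (p + q) + (r + s) ≈ p + s
    +-cancel-middle p {q} {r} s q≈r = begin
      (p + q) + (r + s)   ≈⟨ +-assoc p q (r + s) ⟩
      p + (q + (r + s))   ≈⟨ +-congˡ (+-assoc q r s) ⟨
      p + ((q + r) + s)   ≈⟨ +-congˡ (+-congʳ (≈⇒+≈0 q≈r)) ⟩
      p + (0# + s)        ≈⟨ +-congˡ (+-identityˡ s) ⟩
      p + s               ∎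

    module _ {n} {A B C : Matrix n n}
             (AB≋BA : A ⊗ B ≋ B ⊗ A) (ABᵀ≋BᵀA : A ⊗ B ᵀ ≋ B ᵀ ⊗ A)
             (AC≋CA : A ⊗ C ≋ C ⊗ A) (BBᵀ≋BᵀB : B ⊗ B ᵀ ≋ B ᵀ ⊗ B)
             (BC≋CBᵀ : B ⊗ C ≋ C ⊗ B ᵀ) (BᵀC≋CB : B ᵀ ⊗ C ≋ C ⊗ B)
             (A²+BBᵀ+C²≋I : A ⊗ A ⊕ B ⊗ B ᵀ ⊕ C ⊗ C ≋ I n) where

      upper-left≋I : A ⊗ A ⊕ (B ⊕ C) ⊗ (B ᵀ ⊕ C) ≋ I n
      upper-left≋I i j = begin
        (A ⊗ A) i j + ((B ⊕ C) ⊗ (B ᵀ ⊕ C)) i j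
          ≈⟨ +-congˡ (⊗-expand B C (B ᵀ) C i j) ⟩
        (A ⊗ A) i j + (((B ⊗ B ᵀ) i j + (B ⊗ C) i j) + ((C ⊗ B ᵀ) i j + (C ⊗ C) i j))
          ≈⟨ +-congˡ (+-cancel-middle _ _ (BC≋CBᵀ i j)) ⟩
        (A ⊗ A) i j + ((B ⊗ B ᵀ) i j + (C ⊗ C) i j)
          ≈⟨ +-assoc _ _ _ ⟨
        (A ⊗ A ⊕ B ⊗ B ᵀ ⊕ C ⊗ C) i j
          ≈⟨ A²+BBᵀ+C²≋I i j ⟩
        I n i j ∎

      lower-right≋I : (B ᵀ ⊕ C) ⊗ (B ⊕ C) ⊕ A ⊗ A ≋ I n
      lower-right≋I i j = begin
        ((B ᵀ ⊕ C) ⊗ (B ⊕ C)) i j + (A ⊗ A) i j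
          ≈⟨ +-congʳ (⊗-expand (B ᵀ) C B C i j) ⟩
        (((B ᵀ ⊗ B) i j + (B ᵀ ⊗ C) i j) + ((C ⊗ B) i j + (C ⊗ C) i j)) + (A ⊗ A) i j
          ≈⟨ +-congʳ (+-cancel-middle _ _ (BᵀC≋CB i j)) ⟩
        ((B ᵀ ⊗ B) i j + (C ⊗ C) i j) + (A ⊗ A) i j
          ≈⟨ +-comm _ _ ⟩
        (A ⊗ A) i j + ((B ᵀ ⊗ B) i j + (C ⊗ C) i j)
          ≈⟨ +-congˡ (+-congʳ (BBᵀ≋BᵀB i j)) ⟨
        (A ⊗ A) i j + ((B ⊗ B ᵀ) i j + (C ⊗ C) i j)
          ≈⟨ +-assoc _ _ _ ⟨
        (A ⊗ A ⊕ B ⊗ B ᵀ ⊕ C ⊗ C) i j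
          ≈⟨ A²+BBᵀ+C²≋I i j ⟩
        I n i j ∎

      upper-right≋𝟎 : A ⊗ (B ⊕ C) ⊕ (B ⊕ C) ⊗ A ≋ 𝟎
      upper-right≋𝟎 i j = ≈⇒+≈0 (⊗-comm-⊕ AB≋BA AC≋CA i j)

      lower-left≋𝟎 : (B ᵀ ⊕ C) ⊗ A ⊕ A ⊗ (B ᵀ ⊕ C) ≋ 𝟎
      lower-left≋𝟎 i j = ≈⇒+≈0 (sym (⊗-comm-⊕ ABᵀ≋BᵀA AC≋CA i j))

      blocks-square≋I : blocks A (B ⊕ C) (B ᵀ ⊕ C) A ⊗ blocks A (B ⊕ C) (B ᵀ ⊕ C) A
                        ≋ I (n ℕ.+ n)
      blocks-square≋I p q = begin
        (M ⊗ M) p q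
          ≈⟨ ⊗-blocks A (B ⊕ C) (B ᵀ ⊕ C) A A (B ⊕ C) (B ᵀ ⊕ C) A p q ⟩
        blocks (A ⊗ A ⊕ (B ⊕ C) ⊗ (B ᵀ ⊕ C)) (A ⊗ (B ⊕ C) ⊕ (B ⊕ C) ⊗ A)
               ((B ᵀ ⊕ C) ⊗ A ⊕ A ⊗ (B ᵀ ⊕ C)) ((B ᵀ ⊕ C) ⊗ (B ⊕ C) ⊕ A ⊗ A) p q
          ≈⟨ blocks-cong upper-left≋I upper-right≋𝟎 lower-left≋𝟎 lower-right≋I p q ⟩
        blocks (I n) 𝟎 𝟎 (I n) p q
          ≈⟨ I-blocks n n p q ⟨
        I (n ℕ.+ n) p q ∎
        where
        M : Matrix (n ℕ.+ n) (n ℕ.+ n)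
        M = blocks A (B ⊕ C) (B ᵀ ⊕ C) A

  circulant-blocks-selfDual :
    1# + 1# ≈ 0# → ∀ n .{{_ : NonZero n}} {A B C : Matrix n n} →
    A ≋ A ᵀ → Circulant n A → Circulant n B → ReverseCirculant n C →
    A ⊗ A ⊕ B ⊗ B ᵀ ⊕ C ⊗ C ≋ I n →
    IsSelfDual (CodeGeneratedBy (I (n ℕ.+ n) ∣ blocks A (B ⊕ C) (B ᵀ ⊕ C) A))
  circulant-blocks-selfDual 1+1≈0 n {A} {B} {C} A≋Aᵀ A-circ B-circ C-rev A²+BBᵀ+C²≋I =
    [I∣M]-selfDual M (λ p q → trans (⊗-congʳ M (λ p q → sym (M≋Mᵀ p q)) p q) (M²≋-I p q))
                     (λ p q → trans (⊗-congˡ (λ p q → sym (M≋Mᵀ p q)) M p q) (M²≋-I p q))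
    where
    open Characteristic2 1+1≈0
    M : Matrix (n ℕ.+ n) (n ℕ.+ n)
    M = blocks A (B ⊕ C) (B ᵀ ⊕ C) A
    Bᵀ-circ : Circulant n (B ᵀ)
    Bᵀ-circ = circulant-ᵀ n B-circ
    AC≋CA : A ⊗ C ≋ C ⊗ A
    AC≋CA i j =
      trans (circulant-reverseCirculant n A-circ C-rev i j) (⊗-congʳ C (λ k l → sym (A≋Aᵀ k l)) i j)
    M²≋-I : M ⊗ M ≋ -I (n ℕ.+ n)
    M²≋-I p q = trans (blocks-square≋I (circulant-comm n A-circ B-circ) (circulant-comm n A-circ Bᵀ-circ) AC≋CA
                                       (circulant-comm n B-circ Bᵀ-circ) (circulant-reverseCirculant n B-circ C-rev)
                                       (circulant-reverseCirculant n Bᵀ-circ C-rev) A²+BBᵀ+C²≋I p q)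
                      (sym (-x≈x _))
    M≋Mᵀ : M ≋ M ᵀ
    M≋Mᵀ = blocks-symmetric A≋Aᵀ (λ i j → +-congˡ (reverseCirculant-symmetric n C-rev i j)) A≋Aᵀ

-- Opened only now: Matrices defines the same operator names with the ring fixed.
open Defs
open import Data.Nat using (_+_)

corollary3p2 : ∀ {c ℓ : Level} (R : CommutativeRing c ℓ) → IsFrobenius R → HasChar2 R →
    (n : ℕ) → {{_ : NonZero n}} → (A B C : Matrix R n n) →
    IsSymmetricCirculant R n A → IsCirculant R n B → IsReverseCirculant R n C →
    _≋_ R (_⊕_ R (_⊕_ R (_⊗_ R A A) (_⊗_ R B (_ᵀ R B))) (_⊗_ R C C)) (I R n) →
    IsSelfDual R (CodeGeneratedBy R
      (_∣_ R (I R (n + n)) (blocks R A (_⊕_ R B C) (_⊕_ R (_ᵀ R B) C) A)))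
corollary3p2 R _ (_ , 1+1≈0) n A B C (A-circ , A≋Aᵀ) B-circ C-rev A²+BBᵀ+C²≋I =
  circulant-blocks-selfDual 1+1≈0 n A≋Aᵀ (IsCirculant⇒Circulant n A-circ) (IsCirculant⇒Circulant n B-circ)
    (IsReverseCirculant⇒ReverseCirculant n C-rev) A²+BBᵀ+C²≋I
  where
  open Matrices R
    using (circulant-blocks-selfDual; IsCirculant⇒Circulant; IsReverseCirculant⇒ReverseCirculant)
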